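{- Let $v\equiv 11\pmod{20}$. Consider any decomposition of the edge set of $K_v$ into copies of $K_3$, $K_4$ and $K_5$ with exactly $\frac{v^2+3v+6}{20}$ cliques in total, of which exactly $3$ are copies of $K_3$. Then these three triangles are pairwise vertex-disjoint.
   Context: A decomposition of the edge set of $K_v$ into cliques means a collection of complete subgraphs of $K_v$ such that every edge of $K_v$ lies in exactly one of them. -}

module Defs where

open import Data.Nat using (ℕ; _*_; _+_)
open import Data.Fin using (Fin)
open import Data.List using (List; length; filter; allFin)
open import Data.List.Membership.Propositional using (_∈_)
open import Data.List.Relation.Unary.Unique.Propositional using (Unique)
open import Data.Product using (Σ; _×_; ∃)
open import Data.Sum using (_⊎_)
open import Data.Empty using (⊥)
open import Relation.Binary.PropositionalEquality using (_≡_; _≢_)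
open import Data.Nat.Properties using (_≟_)
open import Data.Nat.DivMod using (_%_)

-- A family of b cliques of K_v, indexed by Fin b; each clique is given
-- by its (duplicate-free) list of vertices in Fin v.
Cliques : ℕ → ℕ → Set
Cliques v b = Fin b → List (Fin v)

IsK345Decomposition : (v b : ℕ) → Cliques v b → Set
IsK345Decomposition v b C =
  ((i : Fin b) → Unique (C i) × (length (C i) ≡ 3 ⊎ length (C i) ≡ 4 ⊎ length (C i) ≡ 5))
  × ((x y : Fin v) → x ≢ y →
       Σ (Fin b) (λ i → (x ∈ C i) × (y ∈ C i))
       × ((i j : Fin b) → x ∈ C i → y ∈ C i → x ∈ C j → y ∈ C j → i ≡ j))

numTriangles : (v b : ℕ) → Cliques v b → ℕ
numTriangles v b C = length (filter (λ i → length (C i) ≟ 3) (allFin b))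

VertexDisjoint : {v : ℕ} → List (Fin v) → List (Fin v) → Set
VertexDisjoint A B = ∀ x → x ∈ A → x ∈ B → ⊥

{-# OPTIONS --safe #-}
-- Let t, f, p be the numbers of triangles, K₄'s and K₅'s through a vertex x. The edges at x
-- give 2t + 3f + 4p = v − 1, and since v ≡ 3 (mod 4) this forces f + 2t ≥ 2, with f + 2t ≥ 4
-- when x lies on two triangles. Summed over all vertices, f + 2t counts 4B₄ + 6B₃, where B_k is
-- the number of k-cliques. Counting cliques and vertex–clique incidences, b = (v² + 3v + 6)/20
-- and B₃ = 3 give exactly 4B₄ + 6B₃ = 2v, leaving no room for a vertex shared by two triangles.
module Submission where

open import Defs

open import Data.Nat using (ℕ; zero; suc; _*_; _+_; _≤_; z≤n; s≤s)
open import Data.Nat.DivMod using (_%_; %-remove-+ˡ; m*n%n≡0; m∣n⇒o%n%m≡o%m)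
open import Data.Nat.Divisibility using (divides; m∣m*n)
open import Data.Nat.Properties
open import Data.Fin using (Fin; zero; suc; punchIn; punchOut)
open import Data.Fin.Properties using (punchInᵢ≢i; punchIn-punchOut) renaming (_≟_ to _≟ᶠ_)
open import Data.Vec.Functional using (removeAt)
open import Data.List using (List; []; _∷_; length; filter; tabulate)
open import Data.List.Membership.Propositional using (_∈_; _∉_)
import Data.List.Relation.Unary.All as All
open import Data.List.Relation.Unary.AllPairs using ([]; _∷_)
open import Data.List.Relation.Unary.Any using (toSum; fromSum)
open import Data.List.Relation.Unary.Unique.Propositional using (Unique)
open import Data.Product using (Σ; _×_; _,_; proj₁; proj₂)
open import Data.Sum using (_⊎_; inj₁; inj₂; [_,_])
open import Function using (_∘′_)
open import Relation.Nullary using (Dec; yes; no; ¬_; contradiction)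
open import Relation.Binary.PropositionalEquality using (_≡_; _≢_; refl; sym; trans; cong; cong₂; subst; module ≡-Reasoning)
open import Data.Nat.Tactic.RingSolver using (solve-∀; solve)
open import Algebra.Properties.Semiring.Sum +-*-semiring
  using (sum; sum-syntax; sum-cong-≗; sum-remove; ∑-distrib-+; ∑-comm; *-distribˡ-sum; *-distribʳ-sum)

private variable P Q R : Set

𝟙 : Dec P → ℕ
𝟙 (yes _) = 1
𝟙 (no _) = 0

𝟙-yes : (a? : Dec P) → P → 𝟙 a? ≡ 1
𝟙-yes (yes _) _ = refl
𝟙-yes (no ¬a) a = contradiction a ¬a

𝟙-no : (a? : Dec P) → ¬ P → 𝟙 a? ≡ 0
𝟙-no (yes a) ¬a = contradiction a ¬a
𝟙-no (no _) _ = refl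

𝟙-idem : (a? : Dec P) → 𝟙 a? * 𝟙 a? ≡ 𝟙 a?
𝟙-idem (yes _) = refl
𝟙-idem (no _) = refl

𝟙*𝟙≡0 : (a? : Dec P) (b? : Dec Q) → ¬ (P × Q) → 𝟙 a? * 𝟙 b? ≡ 0
𝟙*𝟙≡0 (yes a) (yes b) ¬ab = contradiction (a , b) ¬ab
𝟙*𝟙≡0 (yes _) (no _) _ = refl
𝟙*𝟙≡0 (no _) _ _ = refl

𝟙-⊎ : (k? : Dec R) (a? : Dec P) (b? : Dec Q) →
       (R → P ⊎ Q) → (P ⊎ Q → R) → ¬ (P × Q) → 𝟙 k? ≡ 𝟙 a? + 𝟙 b?
𝟙-⊎ k? (yes a) (yes b) _ _ ¬ab = contradiction (a , b) ¬ab
𝟙-⊎ k? (yes a) (no _) _ from _ = 𝟙-yes k? (from (inj₁ a))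
𝟙-⊎ k? (no _) (yes b) _ from _ = 𝟙-yes k? (from (inj₂ b))
𝟙-⊎ k? (no ¬a) (no ¬b) to _ _ = 𝟙-no k? ([ ¬a , ¬b ] ∘′ to)

m*𝟙[m≟k]≡k*𝟙[m≟k] : ∀ m k → m * 𝟙 (m ≟ k) ≡ k * 𝟙 (m ≟ k)
m*𝟙[m≟k]≡k*𝟙[m≟k] m k with m ≟ k
... | yes refl = refl
... | no _ = trans (*-zeroʳ m) (sym (*-zeroʳ k))

∑-const : ∀ n c → ∑[ i < n ] c ≡ n * c
∑-const zero c = refl
∑-const (suc n) c = cong (c +_) (∑-const n c)

∑-mono-≤ : ∀ {n} {f g : Fin n → ℕ} → (∀ i → f i ≤ g i) → sum f ≤ sum g
∑-mono-≤ {zero} f≤g = z≤n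
∑-mono-≤ {suc n} f≤g = +-mono-≤ (f≤g zero) (∑-mono-≤ (λ i → f≤g (suc i)))

term≤∑ : ∀ {n} (f : Fin n → ℕ) k → f k ≤ sum f
term≤∑ {suc n} f k = subst (f k ≤_) (sym (sum-remove {i = k} f)) (m≤m+n (f k) _)

pair≤∑ : ∀ {n} (f : Fin n → ℕ) {i j} → i ≢ j → f i + f j ≤ sum f
pair≤∑ {suc n} f {i} {j} i≢j = begin
  f i + f j                          ≡⟨ cong (λ k → f i + f k) (punchIn-punchOut i≢j) ⟨
  f i + removeAt f i (punchOut i≢j)  ≤⟨ +-monoʳ-≤ (f i) (term≤∑ (removeAt f i) (punchOut i≢j)) ⟩
  f i + sum (removeAt f i)           ≡⟨ sum-remove f ⟨
  sum f                              ∎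
  where open ≤-Reasoning

∑-const-except : ∀ {n} (f : Fin n → ℕ) a {c} → (∀ k → k ≢ a → f k ≡ c) → sum f + c ≡ n * c + f a
∑-const-except {suc n} f a {c} f≡c = begin
  sum f + c                       ≡⟨ cong (_+ c) (sum-remove {i = a} f) ⟩
  f a + sum (removeAt f a) + c    ≡⟨ cong (λ s → f a + s + c) (sum-cong-≗ (λ k → f≡c _ (punchInᵢ≢i a k))) ⟩
  f a + ∑[ k < n ] c + c          ≡⟨ cong (λ s → f a + s + c) (∑-const n c) ⟩
  f a + n * c + c                 ≡⟨ swap-outer (f a) (n * c) c ⟩
  c + n * c + f a                 ∎
  where
  open ≡-Reasoning
  swap-outer : ∀ x y z → x + y + z ≡ z + y + x
  swap-outer = solve-∀

∑-point : ∀ {n} (f : Fin n → ℕ) a → (∀ k → k ≢ a → f k ≡ 0) → sum f ≡ f a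
∑-point {n} f a f≡0 = begin
  sum f          ≡⟨ +-identityʳ (sum f) ⟨
  sum f + 0      ≡⟨ ∑-const-except f a f≡0 ⟩
  n * 0 + f a    ≡⟨ cong (_+ f a) (*-zeroʳ n) ⟩
  f a            ∎
  where open ≡-Reasoning

∑-δ : ∀ {n} (a : Fin n) → ∑[ k < n ] 𝟙 (k ≟ᶠ a) ≡ 1
∑-δ a = trans (∑-point _ a (λ k k≢a → 𝟙-no (k ≟ᶠ a) k≢a)) (𝟙-yes (a ≟ᶠ a) refl)

module _ {n : ℕ} where
  open import Data.List.Membership.DecPropositional (_≟ᶠ_ {n}) using (_∈?_)

  𝟙-∈-∷ : ∀ {a : Fin n} {L} → a ∉ L → ∀ x → 𝟙 (x ∈? a ∷ L) ≡ 𝟙 (x ≟ᶠ a) + 𝟙 (x ∈? L)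
  𝟙-∈-∷ {a} {L} a∉L x = 𝟙-⊎ (x ∈? a ∷ L) (x ≟ᶠ a) (x ∈? L) toSum fromSum
    (λ { (refl , a∈L) → a∉L a∈L })

  ∑-𝟙-∈-Unique : ∀ {L : List (Fin n)} → Unique L → ∑[ x < n ] 𝟙 (x ∈? L) ≡ length L
  ∑-𝟙-∈-Unique {[]} [] = trans (∑-const n 0) (*-zeroʳ n)
  ∑-𝟙-∈-Unique {a ∷ L} (a≢L ∷ unique) = begin
    ∑[ x < n ] 𝟙 (x ∈? a ∷ L)                         ≡⟨ sum-cong-≗ (𝟙-∈-∷ a∉L) ⟩
    ∑[ x < n ] (𝟙 (x ≟ᶠ a) + 𝟙 (x ∈? L))              ≡⟨ ∑-distrib-+ (λ x → 𝟙 (x ≟ᶠ a)) (λ x → 𝟙 (x ∈? L)) ⟩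
    ∑[ x < n ] 𝟙 (x ≟ᶠ a) + ∑[ x < n ] 𝟙 (x ∈? L)    ≡⟨ cong₂ _+_ (∑-δ a) (∑-𝟙-∈-Unique unique) ⟩
    suc (length L)                                    ∎
    where
    open ≡-Reasoning
    a∉L : a ∉ L
    a∉L a∈L = All.lookup a≢L a∈L refl

length-filter-tabulate : ∀ {n} {A : Set} {P : A → Set} (P? : ∀ a → Dec (P a)) (f : Fin n → A) →
  length (filter P? (tabulate f)) ≡ ∑[ i < n ] 𝟙 (P? (f i))
length-filter-tabulate {zero} P? f = refl
length-filter-tabulate {suc n} P? f with P? (f zero)
... | yes _ = cong suc (length-filter-tabulate P? (f ∘′ suc))
... | no _ = length-filter-tabulate P? (f ∘′ suc)

∑-≥-bump : ∀ {n} (g : Fin n → ℕ) {a c} y → (∀ x → a ≤ g x) → a + c ≤ g y → n * a + c ≤ sum g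
∑-≥-bump {suc n} g {a} {c} y a≤g a+c≤gy = begin
  suc n * a + c                 ≡⟨ solve (a ∷ c ∷ n ∷ []) ⟩
  (a + c) + n * a               ≡⟨ cong ((a + c) +_) (∑-const n a) ⟨
  (a + c) + ∑[ k < n ] a        ≤⟨ +-mono-≤ a+c≤gy (∑-mono-≤ (λ k → a≤g (punchIn y k))) ⟩
  g y + sum (removeAt g y)      ≡⟨ sum-remove g ⟨
  sum g                         ∎
  where open ≤-Reasoning

∑-linear₃ : ∀ {n} (a b c : ℕ) (f g h : Fin n → ℕ) →
  ∑[ i < n ] (a * f i + b * g i + c * h i) ≡ a * sum f + b * sum g + c * sum h
∑-linear₃ a b c f g h = begin
  ∑[ i < _ ] (a * f i + b * g i + c * h i)
    ≡⟨ ∑-distrib-+ (λ i → a * f i + b * g i) (λ i → c * h i) ⟩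
  ∑[ i < _ ] (a * f i + b * g i) + ∑[ i < _ ] (c * h i)
    ≡⟨ cong (_+ _) (∑-distrib-+ (λ i → a * f i) (λ i → b * g i)) ⟩
  ∑[ i < _ ] (a * f i) + ∑[ i < _ ] (b * g i) + ∑[ i < _ ] (c * h i)
    ≡⟨ cong₂ _+_ (cong₂ _+_ (*-distribˡ-sum a f) (*-distribˡ-sum b g)) (*-distribˡ-sum c h) ⟨
  a * sum f + b * sum g + c * sum h
    ∎
  where open ≡-Reasoning

split-345 : ∀ {m} → m ≡ 3 ⊎ m ≡ 4 ⊎ m ≡ 5 → (w : ℕ) (g : ℕ → ℕ) →
  w * g m ≡ g 3 * (w * 𝟙 (m ≟ 3)) + g 4 * (w * 𝟙 (m ≟ 4)) + g 5 * (w * 𝟙 (m ≟ 5))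
split-345 (inj₁ refl)        w g = pick₃ w (g 3) (g 4) (g 5)
  where pick₃ : ∀ w x y z → w * x ≡ x * (w * 1) + y * (w * 0) + z * (w * 0)
        pick₃ = solve-∀
split-345 (inj₂ (inj₁ refl)) w g = pick₄ w (g 3) (g 4) (g 5)
  where pick₄ : ∀ w x y z → w * y ≡ x * (w * 0) + y * (w * 1) + z * (w * 0)
        pick₄ = solve-∀
split-345 (inj₂ (inj₂ refl)) w g = pick₅ w (g 3) (g 4) (g 5)
  where pick₅ : ∀ w x y z → w * z ≡ x * (w * 0) + y * (w * 0) + z * (w * 1)
        pick₅ = solve-∀

∑-split-345 : ∀ {n} (s : Fin n → ℕ) → (∀ i → s i ≡ 3 ⊎ s i ≡ 4 ⊎ s i ≡ 5) → (w : Fin n → ℕ) (g : ℕ → ℕ) →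
  ∑[ i < n ] (w i * g (s i)) ≡ g 3 * ∑[ i < n ] (w i * 𝟙 (s i ≟ 3))
                           + g 4 * ∑[ i < n ] (w i * 𝟙 (s i ≟ 4))
                           + g 5 * ∑[ i < n ] (w i * 𝟙 (s i ≟ 5))
∑-split-345 s s∈345 w g =
  trans (sum-cong-≗ (λ i → split-345 (s∈345 i) (w i) g))
        (∑-linear₃ (g 3) (g 4) (g 5) (λ i → w i * 𝟙 (s i ≟ 3)) (λ i → w i * 𝟙 (s i ≟ 4)) (λ i → w i * 𝟙 (s i ≟ 5)))

IsEdgePartition : (v b : ℕ) → Cliques v b → Set
IsEdgePartition v b C =
  (x y : Fin v) → x ≢ y →
    Σ (Fin b) (λ i → (x ∈ C i) × (y ∈ C i))
    × ((i j : Fin b) → x ∈ C i → y ∈ C i → x ∈ C j → y ∈ C j → i ≡ j)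

module Incidence {v b : ℕ} (C : Cliques v b) where
  open import Data.List.Membership.DecPropositional (_≟ᶠ_ {v}) using (_∈?_)

  χ : Fin v → Fin b → ℕ
  χ x i = 𝟙 (x ∈? C i)

  χ-∈ : ∀ {x i} → x ∈ C i → χ x i ≡ 1
  χ-∈ {x} {i} = 𝟙-yes (x ∈? C i)

  handshake : (∀ i → Unique (C i)) → (w : Fin b → ℕ) →
    ∑[ x < v ] ∑[ i < b ] (χ x i * w i) ≡ ∑[ i < b ] (length (C i) * w i)
  handshake unique w = begin
    ∑[ x < v ] ∑[ i < b ] (χ x i * w i)    ≡⟨ ∑-comm (λ x i → χ x i * w i) ⟩
    ∑[ i < b ] ∑[ x < v ] (χ x i * w i)    ≡⟨ sum-cong-≗ (λ i → *-distribʳ-sum (w i) (λ x → χ x i)) ⟨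
    ∑[ i < b ] ((∑[ x < v ] χ x i) * w i)  ≡⟨ sum-cong-≗ (λ i → cong (_* w i) (∑-𝟙-∈-Unique (unique i))) ⟩
    ∑[ i < b ] (length (C i) * w i)        ∎
    where open ≡-Reasoning

  pair-incidence : IsEdgePartition v b C → ∀ {x y} → x ≢ y → ∑[ i < b ] (χ x i * χ y i) ≡ 1
  pair-incidence partition {x} {y} x≢y with partition x y x≢y
  ... | (i₀ , x∈Cᵢ₀ , y∈Cᵢ₀) , unique =
    trans (∑-point _ i₀ off-i₀) (cong₂ _*_ (χ-∈ x∈Cᵢ₀) (χ-∈ y∈Cᵢ₀))
    where
    off-i₀ : ∀ i → i ≢ i₀ → χ x i * χ y i ≡ 0
    off-i₀ i i≢i₀ = 𝟙*𝟙≡0 (x ∈? C i) (y ∈? C i) (λ (x∈Cᵢ , y∈Cᵢ) → i≢i₀ (unique i i₀ x∈Cᵢ y∈Cᵢ x∈Cᵢ₀ y∈Cᵢ₀))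

  degree : (∀ i → Unique (C i)) → IsEdgePartition v b C → ∀ x →
    ∑[ i < b ] (χ x i * length (C i)) + 1 ≡ v + ∑[ i < b ] χ x i
  degree unique partition x = begin
    ∑[ i < b ] (χ x i * length (C i)) + 1          ≡⟨ cong (_+ 1) (sum-cong-≗ λ i → cong (χ x i *_) (∑-𝟙-∈-Unique (unique i))) ⟨
    ∑[ i < b ] (χ x i * ∑[ y < v ] χ y i) + 1      ≡⟨ cong (_+ 1) (sum-cong-≗ λ i → *-distribˡ-sum (χ x i) (λ y → χ y i)) ⟩
    ∑[ i < b ] ∑[ y < v ] (χ x i * χ y i) + 1      ≡⟨ cong (_+ 1) (∑-comm (λ i y → χ x i * χ y i)) ⟩
    ∑[ y < v ] ∑[ i < b ] (χ x i * χ y i) + 1      ≡⟨ ∑-const-except _ x (λ y y≢x → pair-incidence partition (y≢x ∘′ sym)) ⟩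
    v * 1 + ∑[ i < b ] (χ x i * χ x i)             ≡⟨ cong₂ _+_ (*-identityʳ v) (sum-cong-≗ λ i → 𝟙-idem (x ∈? C i)) ⟩
    v + ∑[ i < b ] χ x i                           ∎
    where open ≡-Reasoning

%20≡11⇒%4≡3 : ∀ v → v % 20 ≡ 11 → v % 4 ≡ 3
%20≡11⇒%4≡3 v v%20≡11 = trans (sym (m∣n⇒o%n%m≡o%m 4 20 v (divides 5 refl))) (cong (_% 4) v%20≡11)

2≤f+2t : ∀ {v} t f p → v % 4 ≡ 3 → 2 * t + 3 * f + 4 * p + 1 ≡ v → 2 ≤ f + 2 * t
2≤f+2t (suc t) f p _ _ = ≤-trans (*-monoʳ-≤ 2 (s≤s z≤n)) (m≤n+m (2 * suc t) f)
2≤f+2t zero (suc (suc f)) p _ _ = s≤s (s≤s z≤n)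
2≤f+2t zero zero p v%4≡3 refl = contradiction (trans (sym v%4≡3) (%-remove-+ˡ 1 (m∣m*n p))) λ ()
2≤f+2t zero (suc zero) p v%4≡3 refl =
  contradiction (trans (sym v%4≡3) (trans (cong (_% 4) v≡[1+p]*4) (m*n%n≡0 (suc p) 4))) λ ()
  where
  v≡[1+p]*4 : 3 + 4 * p + 1 ≡ suc p * 4
  v≡[1+p]*4 = solve (p ∷ [])

v*2≡4B₄+6B₃ : ∀ {v b B₃ B₄ B₅} → B₃ ≡ 3 → b ≡ B₃ + B₄ + B₅ →
  2 * (3 * B₃) + 3 * (4 * B₄) + 4 * (5 * B₅) + v ≡ v * v → 20 * b ≡ v * v + 3 * v + 6 →
  v * 2 ≡ 4 * B₄ + 2 * (3 * B₃)
v*2≡4B₄+6B₃ {v} {b} {B₄ = B₄} {B₅} refl b≡ incidences 20b≡ =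
  *-cancelʳ-≡ (v * 2) (4 * B₄ + 18) 2 (+-cancelʳ-≡ (24 + 12 * B₄ + 20 * B₅) _ _ (begin
    v * 2 * 2 + (24 + 12 * B₄ + 20 * B₅)                 ≡⟨ solve (v ∷ B₄ ∷ B₅ ∷ []) ⟩
    2 * (3 * 3) + 3 * (4 * B₄) + 4 * (5 * B₅) + v + 3 * v + 6  ≡⟨ cong (λ n → n + 3 * v + 6) incidences ⟩
    v * v + 3 * v + 6                                    ≡⟨ 20b≡ ⟨
    20 * b                                               ≡⟨ cong (20 *_) b≡ ⟩
    20 * (3 + B₄ + B₅)                                   ≡⟨ solve (B₄ ∷ B₅ ∷ []) ⟩
    (4 * B₄ + 18) * 2 + (24 + 12 * B₄ + 20 * B₅)         ∎))
  where open ≡-Reasoning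

module K345 {v b : ℕ} {C : Cliques v b} (D : IsK345Decomposition v b C) where
  open Incidence C

  size : Fin b → ℕ
  size i = length (C i)

  B : ℕ → ℕ
  B k = ∑[ i < b ] 𝟙 (size i ≟ k)

  through : Fin v → ℕ → ℕ
  through x k = ∑[ i < b ] (χ x i * 𝟙 (size i ≟ k))

  unique : ∀ i → Unique (C i)
  unique i = proj₁ (proj₁ D i)

  sizes : ∀ i → size i ≡ 3 ⊎ size i ≡ 4 ⊎ size i ≡ 5
  sizes i = proj₂ (proj₁ D i)

  vertex-equation : ∀ x → 2 * through x 3 + 3 * through x 4 + 4 * through x 5 + 1 ≡ v
  vertex-equation x = subtract-replication (through x 3) (through x 4) (through x 5) (begin
      3 * through x 3 + 4 * through x 4 + 5 * through x 5 + 1  ≡⟨ cong (_+ 1) (∑-split-345 size sizes (χ x) (λ m → m)) ⟨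
      ∑[ i < b ] (χ x i * size i) + 1                          ≡⟨ degree unique (proj₂ D) x ⟩
      v + ∑[ i < b ] χ x i                                     ≡⟨ cong (v +_) (sum-cong-≗ λ i → *-identityʳ (χ x i)) ⟨
      v + ∑[ i < b ] (χ x i * 1)                               ≡⟨ cong (v +_) (∑-split-345 size sizes (χ x) (λ _ → 1)) ⟩
      v + (1 * through x 3 + 1 * through x 4 + 1 * through x 5) ∎)
    where
    open ≡-Reasoning
    subtract-replication : ∀ t f p → 3 * t + 4 * f + 5 * p + 1 ≡ v + (1 * t + 1 * f + 1 * p) →
                           2 * t + 3 * f + 4 * p + 1 ≡ v
    subtract-replication t f p eq = +-cancelˡ-≡ (t + f + p) _ _ (begin
      (t + f + p) + (2 * t + 3 * f + 4 * p + 1)  ≡⟨ solve (t ∷ f ∷ p ∷ []) ⟩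
      3 * t + 4 * f + 5 * p + 1                  ≡⟨ eq ⟩
      v + (1 * t + 1 * f + 1 * p)                ≡⟨ solve (v ∷ t ∷ f ∷ p ∷ []) ⟩
      (t + f + p) + v                            ∎)

  ∑-through : ∀ k → ∑[ x < v ] through x k ≡ k * B k
  ∑-through k = begin
    ∑[ x < v ] through x k                       ≡⟨ handshake unique (λ i → 𝟙 (size i ≟ k)) ⟩
    ∑[ i < b ] (size i * 𝟙 (size i ≟ k))         ≡⟨ sum-cong-≗ (λ i → m*𝟙[m≟k]≡k*𝟙[m≟k] (size i) k) ⟩
    ∑[ i < b ] (k * 𝟙 (size i ≟ k))              ≡⟨ *-distribˡ-sum k (λ i → 𝟙 (size i ≟ k)) ⟨
    k * B k                                      ∎
    where open ≡-Reasoning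

  incidence-count : 2 * (3 * B 3) + 3 * (4 * B 4) + 4 * (5 * B 5) + v ≡ v * v
  incidence-count = begin
    2 * (3 * B 3) + 3 * (4 * B 4) + 4 * (5 * B 5) + v
      ≡⟨ cong₂ _+_ (cong₂ _+_ (cong₂ _+_ (cong (2 *_) (∑-through 3)) (cong (3 *_) (∑-through 4))) (cong (4 *_) (∑-through 5)))
                   (*-identityʳ v) ⟨
    2 * ∑[ x < v ] through x 3 + 3 * ∑[ x < v ] through x 4 + 4 * ∑[ x < v ] through x 5 + v * 1
      ≡⟨ cong₂ _+_ (∑-linear₃ 2 3 4 (λ x → through x 3) (λ x → through x 4) (λ x → through x 5)) (∑-const v 1) ⟨
    ∑[ x < v ] (2 * through x 3 + 3 * through x 4 + 4 * through x 5) + ∑[ x < v ] 1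
      ≡⟨ ∑-distrib-+ (λ x → 2 * through x 3 + 3 * through x 4 + 4 * through x 5) (λ _ → 1) ⟨
    ∑[ x < v ] (2 * through x 3 + 3 * through x 4 + 4 * through x 5 + 1)
      ≡⟨ sum-cong-≗ vertex-equation ⟩
    ∑[ x < v ] v
      ≡⟨ ∑-const v v ⟩
    v * v ∎
    where open ≡-Reasoning

  b≡B₃+B₄+B₅ : b ≡ B 3 + B 4 + B 5
  b≡B₃+B₄+B₅ = begin
    b                     ≡⟨ *-identityʳ b ⟨
    b * 1                 ≡⟨ ∑-const b 1 ⟨
    ∑[ i < b ] 1          ≡⟨ ∑-split-345 size sizes (λ _ → 1) (λ _ → 1) ⟩
    1 * B′ 3 + 1 * B′ 4 + 1 * B′ 5  ≡⟨ cong₂ _+_ (cong₂ _+_ (B′≡B 3) (B′≡B 4)) (B′≡B 5) ⟩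
    B 3 + B 4 + B 5       ∎
    where
    open ≡-Reasoning
    B′ : ℕ → ℕ
    B′ k = ∑[ i < b ] (1 * 𝟙 (size i ≟ k))
    B′≡B : ∀ k → 1 * B′ k ≡ B k
    B′≡B k = trans (*-identityˡ (B′ k)) (sum-cong-≗ λ i → *-identityˡ (𝟙 (size i ≟ k)))

  numTriangles≡B₃ : numTriangles v b C ≡ B 3
  numTriangles≡B₃ = length-filter-tabulate (λ i → size i ≟ 3) (λ i → i)

  shared-vertex-bound : v % 4 ≡ 3 → ∀ {i j y} → i ≢ j → size i ≡ 3 → size j ≡ 3 → y ∈ C i → y ∈ C j →
    v * 2 + 2 ≤ 4 * B 4 + 2 * (3 * B 3)
  shared-vertex-bound v%4≡3 {i} {j} {y} i≢j |Cᵢ|≡3 |Cⱼ|≡3 y∈Cᵢ y∈Cⱼ = begin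
    v * 2 + 2                                               ≤⟨ ∑-≥-bump g y 2≤g 4≤g[y] ⟩
    ∑[ x < v ] g x                                          ≡⟨ ∑-distrib-+ (λ x → through x 4) (λ x → 2 * through x 3) ⟩
    ∑[ x < v ] through x 4 + ∑[ x < v ] (2 * through x 3)   ≡⟨ cong (∑[ x < v ] through x 4 +_) (*-distribˡ-sum 2 (λ x → through x 3)) ⟨
    ∑[ x < v ] through x 4 + 2 * ∑[ x < v ] through x 3     ≡⟨ cong₂ _+_ (∑-through 4) (cong (2 *_) (∑-through 3)) ⟩
    4 * B 4 + 2 * (3 * B 3)                                 ∎
    where
    open ≤-Reasoning
    g : Fin v → ℕ
    g x = through x 4 + 2 * through x 3
    2≤g : ∀ x → 2 ≤ g x
    2≤g x = 2≤f+2t (through x 3) (through x 4) (through x 5) v%4≡3 (vertex-equation x)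
    incident-triangle : ∀ {k} → size k ≡ 3 → y ∈ C k → χ y k * 𝟙 (size k ≟ 3) ≡ 1
    incident-triangle {k} |Cₖ|≡3 y∈Cₖ = cong₂ _*_ (χ-∈ y∈Cₖ) (𝟙-yes (size k ≟ 3) |Cₖ|≡3)
    2≤triangles[y] : 2 ≤ through y 3
    2≤triangles[y] = subst (_≤ through y 3) (cong₂ _+_ (incident-triangle |Cᵢ|≡3 y∈Cᵢ) (incident-triangle |Cⱼ|≡3 y∈Cⱼ))
                           (pair≤∑ (λ k → χ y k * 𝟙 (size k ≟ 3)) i≢j)
    4≤g[y] : 2 + 2 ≤ g y
    4≤g[y] = ≤-trans (*-monoʳ-≤ 2 2≤triangles[y]) (m≤n+m (2 * through y 3) (through y 4))

proposition8 : (v b : ℕ) → v % 20 ≡ 11 → (C : Cliques v b) →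
    IsK345Decomposition v b C →
    20 * b ≡ v * v + 3 * v + 6 →
    numTriangles v b C ≡ 3 →
    (i j : Fin b) → i ≢ j → length (C i) ≡ 3 → length (C j) ≡ 3 →
    VertexDisjoint (C i) (C j)
proposition8 v b v%20≡11 C D 20b≡ #triangles≡3 i j i≢j |Cᵢ|≡3 |Cⱼ|≡3 y y∈Cᵢ y∈Cⱼ =
  m+1+n≰m (v * 2) (begin
    v * 2 + 2                ≤⟨ shared-vertex-bound (%20≡11⇒%4≡3 v v%20≡11) i≢j |Cᵢ|≡3 |Cⱼ|≡3 y∈Cᵢ y∈Cⱼ ⟩
    4 * B 4 + 2 * (3 * B 3)  ≡⟨ v*2≡4B₄+6B₃ B₃≡3 b≡B₃+B₄+B₅ incidence-count 20b≡ ⟨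
    v * 2                    ∎)
  where
  open K345 D
  open ≤-Reasoning
  B₃≡3 : B 3 ≡ 3
  B₃≡3 = trans (sym numTriangles≡B₃) #triangles≡3
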